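{- Let $a,d,h,x$ be positive integers with $\gcd(a,d)=1$ and $1\leq x\leq a-1$, and let $S=\langle a,ha+d,\ldots,ha+xd\rangle$. Then $$\mathrm{t}(S)=\omega(S)=\Big(\left\lceil\frac{a-1}{x}\right\rceil+1\Big)h+d.$$
   Context: $\mathbb{N}=\{0,1,2,\ldots\}$ and $\langle\cdots\rangle$ denotes the submonoid of $\mathbb{N}$ generated by the listed integers. The minimal generators of $S$ are $n_0=a$ and $n_j=ha+jd$ for $1\leq j\leq x$. For $u,v\in S$ write $u\leq_S v$ if $v-u\in S$. A factorization of $n\in S$ is a tuple $z=(z_0,\ldots,z_x)\in\mathbb{N}^{x+1}$ with $\sum_j z_jn_j=n$. $\mathsf{Z}(n)$ is the set of factorizations of $n$, and $|z|=\sum_jz_j$ is the length of $z$. For $z,z'\in\mathbb{N}^{x+1}$ with componentwise minimum $\gcd(z,z')$, the distance is $$\mathrm{d}(z,z')=\max\{|z-\gcd(z,z')|,|z'-\gcd(z,z')|\}.$$ For a nonempty set $Y$ of factorizations, $\mathrm{d}(z,Y)=\min_{y\in Y}\mathrm{d}(z,y)$. Tame degree: for $0\leq i\leq x$, let $\mathsf{Z}^i(n)=\{z\in\mathsf{Z}(n): z_i\neq0\}$. If $n-n_i\in S$, set $$\mathrm{t}_i(n)=\max\{\mathrm{d}(z,\mathsf{Z}^i(n)) : z\in\mathsf{Z}(n)\}.$$ Let $\mathrm{t}(n)=\max\{\mathrm{t}_i(n): n-n_i\in S\}$, and $\mathrm{t}(S)=\max\{\mathrm{t}(n): n\in S\}$.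 $\omega$ invariant: for $u,b\in S$ with $b\leq_S u$, $\omega(u,b)$ is the smallest $N\in\mathbb{N}\cup\{\infty\}$ with the following property. For every $m\in\mathbb{N}$ and every $u_1,\ldots,u_m\in S$ with $u=u_1+\cdots+u_m$, there is a subset $\Omega\subseteq\{1,\ldots,m\}$ with $|\Omega|\leq N$ and $b\leq_S\sum_{\nu\in\Omega}u_\nu$. If $b\not\leq_S u$, set $\omega(u,b)=0$. Then $\omega(S,b)=\sup_{u\in S}\omega(u,b)$, and $\omega(S)=\sup\{\omega(S,n_i): 0\leq i\leq x\}$. -}

module Defs where

open import Data.Nat using (ℕ; zero; suc; _+_; _*_; _∸_; _≤_; _⊓_; _⊔_)
open import Data.Nat.DivMod using (_/_)
open import Data.Fin using (Fin; zero; suc; toℕ)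
open import Data.List using (List; length)
open import Data.Nat.ListAction using (sum)
open import Data.List.Relation.Unary.All using (All)
open import Data.List.Relation.Binary.Sublist.Propositional using (_⊆_)
open import Data.Product using (Σ; ∃; _×_)
open import Relation.Binary.PropositionalEquality using (_≡_; _≢_)
open import Relation.Nullary using (¬_)

sumFin : ∀ {k} → (Fin k → ℕ) → ℕ
sumFin {zero}  f = 0
sumFin {suc k} f = f zero + sumFin (λ j → f (suc j))

-- ceiling division ⌈ m / n ⌉ (value for n = 0 is irrelevant)
ceilDiv : ℕ → ℕ → ℕ
ceilDiv m zero    = 0
ceilDiv m (suc k) = (m + k) / suc k

module Monoid {k : ℕ} (gens : Fin k → ℕ) where

  Factorization : Set
  Factorization = Fin k → ℕ

  eval : Factorization → ℕ
  eval z = sumFin (λ j → z j * gens j)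

  IsFact : ℕ → Factorization → Set
  IsFact n z = eval z ≡ n

  InS : ℕ → Set
  InS n = ∃ λ z → IsFact n z

  _≤S_ : ℕ → ℕ → Set
  u ≤S v = u ≤ v × InS (v ∸ u)

  len : Factorization → ℕ
  len z = sumFin z

  gcdF : Factorization → Factorization → Factorization
  gcdF z z' j = z j ⊓ z' j

  dist : Factorization → Factorization → ℕ
  dist z z' = len (λ j → z j ∸ gcdF z z' j) ⊔ len (λ j → z' j ∸ gcdF z z' j)

  TameDegreeIs : ℕ → Set
  TameDegreeIs T =
    (∀ (n : ℕ) (i : Fin k) → gens i ≤S n → ∀ (z : Factorization) → IsFact n z →
       ∃ λ (y : Factorization) → IsFact n y × y i ≢ 0 × dist z y ≤ T)
    × (Σ ℕ λ n → Σ (Fin k) λ i → gens i ≤S n × Σ Factorization λ z → IsFact n z ×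
       (∀ (y : Factorization) → IsFact n y → y i ≢ 0 → T ≤ dist z y))

  -- the defining property of ω(u,b) ≤ N: every decomposition u = u_1+…+u_m in S
  -- has a subfamily (sub-multiset of positions, i.e. a sublist) of size ≤ N whose
  -- sum is ≥_S b
  OmegaBound : ℕ → ℕ → ℕ → Set
  OmegaBound u b N =
    ∀ (us : List ℕ) → All InS us → sum us ≡ u →
      ∃ λ (Ω : List ℕ) → Ω ⊆ us × length Ω ≤ N × b ≤S sum Ω

  -- ω(S) = T (T ≥ 1): every ω(u, n_i) ≤ T, and some ω(u, n_i) > T - 1
  OmegaIs : ℕ → Set
  OmegaIs T =
    (∀ (i : Fin k) (u : ℕ) → gens i ≤S u → OmegaBound u (gens i) T)
    × (Σ (Fin k) λ i → Σ ℕ λ u → gens i ≤S u × ¬ OmegaBound u (gens i) (T ∸ 1))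

arithGens : (a d h x : ℕ) → Fin (suc x) → ℕ
arithGens a d h x zero    = a
arithGens a d h x (suc j) = h * a + suc (toℕ j) * d

{-# OPTIONS --safe #-}

-- Every element of S has a factorization w with eval w = L a + r d, r < a and |w| ≤ L (reduce the
-- index sum modulo a); conversely L a + r d ∈ S whenever h ⌈r/x⌉ ≤ L. Since gcd(a, d) = 1, two such
-- expressions of one number with r, r′ close to each other have comparable a-coefficients.
--
-- Upper bounds, with q = ⌈(a − 1)/x⌉ and T = (q + 1) h + d. Given z with n_i ≤_S eval z, drop atoms
-- from z while n_i ≤_S survives. When no atom can be dropped, write eval z = n_i + L a + r d as above:
-- dropping a, or n_j with j ≤ r, or n_j with j > r would leave (L − 1) a + r d, (L − h) a + (r − j) d
-- or (L − h − d) a + (r + a − j) d, which lie in S unless L < T; comparing a-coefficients in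
-- eval z = n_i + L a + r d then gives |z| ≤ T. This sub-factorization of z yields both the
-- factorization using n_i at distance at most T from z (tame degree) and the subfamily of at most
-- T summands (ω).
--
-- For J = a − 1 − x (q − 1) ∈ [1, x], a factorization of a multiple c a that uses n_J
-- has index sum at least a − J, hence at least q further atoms n_j, so c ≥ T. Applied to
-- T a = T · n₀ this gives both t(S) ≥ T and ω(S) ≥ T.

module Submission where

open import Defs
open import Data.Nat
  using (ℕ; zero; suc; _+_; _*_; _∸_; _≤_; _<_; _⊓_; _⊔_; z≤n; s≤s; s≤s⁻¹; z<s; NonZero; >-nonZero; _≤?_; _<?_)
open import Data.Nat.Properties
open import Data.Nat.Tactic.RingSolver using (solve-∀)
open import Data.Nat.DivMod using (_/_; _%_; m≡m%n+[m/n]*n; m%n<n; m<n*o⇒m/o<n)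
open import Data.Nat.Divisibility using (divides; ∣⇒≤)
open import Data.Nat.GCD using (gcd)
open import Data.Nat.Coprimality using (Coprime; coprime-divisor; gcd≡1⇒coprime)
open import Data.Fin using (Fin; zero; suc; toℕ; fromℕ<)
open import Data.Fin.Properties using (toℕ<n; toℕ-fromℕ<)
open import Data.Product using (Σ; ∃; ∃₂; _,_; _×_; proj₁)
open import Data.Sum using (_⊎_; inj₁; inj₂)
open import Data.List using (List; []; _∷_; length; replicate)
open import Data.List.Properties using (length-replicate)
open import Data.Nat.ListAction using (sum)
open import Data.List.Relation.Unary.All using (All; []; _∷_)
open import Data.List.Relation.Unary.All.Properties using (replicate⁺)
open import Data.List.Relation.Binary.Sublist.Propositional using (_⊆_; []; _∷_; _∷ʳ_)
open import Data.List.Relation.Binary.Sublist.Propositional.Properties using (All-resp-⊆)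
open import Relation.Nullary using (¬_; yes; no; contradiction)
open import Relation.Binary.PropositionalEquality
  using (_≡_; _≢_; _≗_; refl; sym; trans; cong; cong₂; subst; subst₂; module ≡-Reasoning)

sumFin-cong : ∀ {k} {f g : Fin k → ℕ} → f ≗ g → sumFin f ≡ sumFin g
sumFin-cong {zero}  _ = refl
sumFin-cong {suc k} f≗g = cong₂ _+_ (f≗g zero) (sumFin-cong (λ j → f≗g (suc j)))

sumFin-+ : ∀ {k} (f g : Fin k → ℕ) → sumFin (λ j → f j + g j) ≡ sumFin f + sumFin g
sumFin-+ {zero}  f g = refl
sumFin-+ {suc k} f g = begin
  f zero + g zero + sumFin (λ j → f (suc j) + g (suc j))
    ≡⟨ cong (f zero + g zero +_) (sumFin-+ (λ j → f (suc j)) (λ j → g (suc j))) ⟩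
  f zero + g zero + (sumFin (λ j → f (suc j)) + sumFin (λ j → g (suc j)))
    ≡⟨ +-interchange (f zero) (g zero) _ _ ⟩
  f zero + sumFin (λ j → f (suc j)) + (g zero + sumFin (λ j → g (suc j))) ∎
  where
  open ≡-Reasoning
  +-interchange : ∀ m n o p → m + n + (o + p) ≡ m + o + (n + p)
  +-interchange = solve-∀

sumFin-* : ∀ {k} (c : ℕ) (f : Fin k → ℕ) → sumFin (λ j → c * f j) ≡ c * sumFin f
sumFin-* {zero}  c f = sym (*-zeroʳ c)
sumFin-* {suc k} c f = trans (cong (c * f zero +_) (sumFin-* c (λ j → f (suc j))))
                             (sym (*-distribˡ-+ c (f zero) _))

sumFin-zero : ∀ {k} → sumFin {k} (λ _ → 0) ≡ 0
sumFin-zero {zero}  = refl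
sumFin-zero {suc k} = sumFin-zero {k}

sumFin-mono : ∀ {k} {f g : Fin k → ℕ} → (∀ j → f j ≤ g j) → sumFin f ≤ sumFin g
sumFin-mono {zero}  _   = z≤n
sumFin-mono {suc k} f≤g = +-mono-≤ (f≤g zero) (sumFin-mono (λ j → f≤g (suc j)))

term≤sumFin : ∀ {k} (f : Fin k → ℕ) (j : Fin k) → f j ≤ sumFin f
term≤sumFin f zero    = m≤m+n (f zero) _
term≤sumFin f (suc j) = ≤-trans (term≤sumFin (λ i → f (suc i)) j) (m≤n+m _ (f zero))

sumFin≡0 : ∀ {k} (f : Fin k → ℕ) → sumFin f ≡ 0 → ∀ j → f j ≡ 0
sumFin≡0 f eq j = n≤0⇒n≡0 (subst (f j ≤_) eq (term≤sumFin f j))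

sumFin-pos : ∀ {k} (f : Fin k → ℕ) → 1 ≤ sumFin f → ∃ λ j → 1 ≤ f j
sumFin-pos {suc k} f pos with f zero in eq
... | suc _ = zero , subst (1 ≤_) (sym eq) (s≤s z≤n)
... | zero with sumFin-pos (λ j → f (suc j)) pos
...   | j , 1≤fj = suc j , 1≤fj

unit : ∀ {k} → Fin k → Fin k → ℕ
unit zero    zero    = 1
unit zero    (suc _) = 0
unit (suc _) zero    = 0
unit (suc l) (suc j) = unit l j

unit-self : ∀ {k} (l : Fin k) → unit l l ≡ 1
unit-self zero    = refl
unit-self (suc l) = unit-self l

sumFin-unit : ∀ {k} (l : Fin k) (g : Fin k → ℕ) → sumFin (λ j → unit l j * g j) ≡ g l
sumFin-unit {suc k} zero    g =
  trans (cong (g zero + 0 +_) (sumFin-zero {k})) (trans (+-identityʳ _) (+-identityʳ _))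
sumFin-unit {suc k} (suc l) g = sumFin-unit l (λ j → g (suc j))

unit-≤ : ∀ {k} (l : Fin k) (f : Fin k → ℕ) → 1 ≤ f l → ∀ j → unit l j ≤ f j
unit-≤ zero    f 1≤fl zero    = 1≤fl
unit-≤ zero    f 1≤fl (suc j) = z≤n
unit-≤ (suc l) f 1≤fl zero    = z≤n
unit-≤ (suc l) f 1≤fl (suc j) = unit-≤ l (λ i → f (suc i)) 1≤fl j

sumFin-unit≡1 : ∀ {k} (l : Fin k) → sumFin (unit l) ≡ 1
sumFin-unit≡1 l = trans (sumFin-cong (λ j → sym (*-identityʳ (unit l j)))) (sumFin-unit l (λ _ → 1))

[m+n]∸[m+n]⊓[m+o]≤n : ∀ p u v → (p + u) ∸ ((p + u) ⊓ (p + v)) ≤ u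
[m+n]∸[m+n]⊓[m+o]≤n p u v = begin
  (p + u) ∸ ((p + u) ⊓ (p + v)) ≡⟨ cong ((p + u) ∸_) (+-distribˡ-⊓ p u v) ⟨
  (p + u) ∸ (p + (u ⊓ v))       ≡⟨ [m+n]∸[m+o]≡n∸o p u (u ⊓ v) ⟩
  u ∸ (u ⊓ v)                   ≤⟨ m∸n≤m u (u ⊓ v) ⟩
  u                             ∎
  where open ≤-Reasoning

sum-copies : ∀ {m} {Ω : List ℕ} → All (_≡ m) Ω → sum Ω ≡ length Ω * m
sum-copies []          = refl
sum-copies (refl ∷ ps) = cong (_ +_) (sum-copies ps)

module Factorizations {k : ℕ} (gens : Fin k → ℕ) where
  open Monoid gens public

  _⊕_ : Factorization → Factorization → Factorization
  (u ⊕ v) j = u j + v j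

  _≼_ : Factorization → Factorization → Set
  u ≼ v = ∀ j → u j ≤ v j

  ≼-refl : ∀ {u} → u ≼ u
  ≼-refl j = ≤-refl

  ≼-trans : ∀ {u v w} → u ≼ v → v ≼ w → u ≼ w
  ≼-trans u≼v v≼w j = ≤-trans (u≼v j) (v≼w j)

  zeroᶠ : Factorization
  zeroᶠ _ = 0

  _·unit_ : ℕ → Fin k → Factorization
  (n ·unit l) j = n * unit l j

  eval-cong : ∀ {u v} → u ≗ v → eval u ≡ eval v
  eval-cong u≗v = sumFin-cong (λ j → cong (_* gens j) (u≗v j))

  len-cong : ∀ {u v} → u ≗ v → len u ≡ len v
  len-cong = sumFin-cong

  eval-zero : eval zeroᶠ ≡ 0
  eval-zero = sumFin-zero {k}

  eval-⊕ : ∀ u v → eval (u ⊕ v) ≡ eval u + eval v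
  eval-⊕ u v = trans (sumFin-cong (λ j → *-distribʳ-+ (gens j) (u j) (v j)))
                     (sumFin-+ (λ j → u j * gens j) (λ j → v j * gens j))

  len-⊕ : ∀ u v → len (u ⊕ v) ≡ len u + len v
  len-⊕ = sumFin-+

  eval-unit : ∀ l → eval (unit l) ≡ gens l
  eval-unit l = sumFin-unit l gens

  eval-·unit : ∀ n l → eval (n ·unit l) ≡ n * gens l
  eval-·unit n l = begin
    sumFin (λ j → n * unit l j * gens j)   ≡⟨ sumFin-cong (λ j → *-assoc n (unit l j) (gens j)) ⟩
    sumFin (λ j → n * (unit l j * gens j)) ≡⟨ sumFin-* n (λ j → unit l j * gens j) ⟩
    n * eval (unit l)                      ≡⟨ cong (n *_) (eval-unit l) ⟩
    n * gens l                             ∎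
    where open ≡-Reasoning

  eval-drop : ∀ {z z₁ l} → z ≗ z₁ ⊕ unit l → eval z ≡ eval z₁ + gens l
  eval-drop {z} {z₁} {l} z≗ = trans (eval-cong z≗) (trans (eval-⊕ z₁ (unit l)) (cong (eval z₁ +_) (eval-unit l)))

  len-drop : ∀ {z z₁ l} → z ≗ z₁ ⊕ unit l → len z ≡ suc (len z₁)
  len-drop {z} {z₁} {l} z≗ = trans (len-cong z≗)
    (trans (len-⊕ z₁ (unit l)) (trans (cong (len z₁ +_) (sumFin-unit≡1 l)) (+-comm (len z₁) 1)))

  atom-pos : ∀ {z z₁ l} → z ≗ z₁ ⊕ unit l → 1 ≤ z l
  atom-pos {z} {z₁} {l} z≗ =
    subst (1 ≤_) (sym (z≗ l)) (≤-trans (≤-reflexive (sym (unit-self l))) (m≤n+m _ (z₁ l)))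

  drop-atom : ∀ z l → 1 ≤ z l → ∃ λ z₁ → z ≗ z₁ ⊕ unit l
  drop-atom z l 1≤zl = (λ j → z j ∸ unit l j) , λ j → sym (m∸n+n≡m (unit-≤ l z 1≤zl j))

  atom-of-pos : ∀ z → 1 ≤ eval z → ∃ λ l → 1 ≤ z l
  atom-of-pos z pos with sumFin-pos (λ j → z j * gens j) pos
  ... | l , 1≤zg = l , pos-factor (z l) 1≤zg
    where
    pos-factor : ∀ m {n} → 1 ≤ m * n → 1 ≤ m
    pos-factor (suc _) _ = s≤s z≤n

  inS-+ : ∀ {m n} → InS m → InS n → InS (m + n)
  inS-+ (u , eu) (v , ev) = u ⊕ v , trans (eval-⊕ u v) (cong₂ _+_ eu ev)

  inS-multiple : ∀ n l → InS (n * gens l)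
  inS-multiple n l = n ·unit l , eval-·unit n l

  ≤S-intro : ∀ {b n} (w : Factorization) → b + eval w ≡ n → b ≤S n
  ≤S-intro {b} w refl = m≤m+n b (eval w) , w , sym (m+n∸m≡n b (eval w))

  ≤S-elim : ∀ {b n} → b ≤S n → ∃ λ w → b + eval w ≡ n
  ≤S-elim {b} (b≤n , w , ew) = w , trans (cong (b +_) ew) (m+[n∸m]≡n b≤n)

  ≤S-trans : ∀ {m n o} → m ≤S n → n ≤S o → m ≤S o
  ≤S-trans {m} m≤n n≤o with ≤S-elim m≤n | ≤S-elim n≤o
  ... | u , refl | v , refl = ≤S-intro (u ⊕ v)
    (trans (cong (m +_) (eval-⊕ u v)) (sym (+-assoc m (eval u) (eval v))))

  ≤S-+ : ∀ {m n m′ n′} → m ≤S n → m′ ≤S n′ → (m + m′) ≤S (n + n′)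
  ≤S-+ {m} {_} {m′} m≤n m′≤n′ with ≤S-elim m≤n | ≤S-elim m′≤n′
  ... | u , refl | v , refl = ≤S-intro (u ⊕ v)
    (trans (cong (m + m′ +_) (eval-⊕ u v)) (+-interchange m m′ (eval u) (eval v)))
    where
    +-interchange : ∀ m n o p → m + n + (o + p) ≡ m + o + (n + p)
    +-interchange = solve-∀

  ≼⇒≤S : ∀ {u v} → u ≼ v → eval u ≤S eval v
  ≼⇒≤S {u} {v} u≼v = ≤S-intro (λ j → v j ∸ u j)
    (trans (sym (eval-⊕ u _)) (eval-cong (λ j → m+[n∸m]≡n (u≼v j))))

  Shrinkable : ℕ → Factorization → Set
  Shrinkable b z = Σ (Fin k) λ l → Σ Factorization λ z₁ → z ≗ z₁ ⊕ unit l × b ≤S eval z₁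

  Compact : ℕ → ℕ → Factorization → Set
  Compact T b z = len z ≤ T × Σ Factorization λ w → eval z ≡ b + eval w × len w < T

  Covered : ℕ → ℕ → Factorization → Set
  Covered T b z = Σ Factorization λ z′ → z′ ≼ z × Compact T b z′

  descend : ∀ {T b} → (∀ z → b ≤S eval z → Shrinkable b z ⊎ Compact T b z) →
            ∀ z → b ≤S eval z → Covered T b z
  descend {T} {b} step z = go (len z) z ≤-refl
    where
    go : ∀ n z → len z ≤ n → b ≤S eval z → Covered T b z
    go n z lz b≤z with step z b≤z
    ... | inj₂ compact = z , ≼-refl , compact
    go zero    z lz b≤z | inj₁ (l , z₁ , z≗ , _) with () ← subst (_≤ 0) (len-drop {z} {z₁} {l} z≗) lz
    go (suc n) z lz b≤z | inj₁ (l , z₁ , z≗ , b≤z₁)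
      with go n z₁ (s≤s⁻¹ (subst (_≤ suc n) (len-drop {z} {z₁} {l} z≗) lz)) b≤z₁
    ... | z′ , z′≼z₁ , compact = z′ , ≼-trans z′≼z₁ z₁≼z , compact
      where
      z₁≼z : z₁ ≼ z
      z₁≼z j = subst (z₁ j ≤_) (sym (z≗ j)) (m≤m+n (z₁ j) _)

  dist-≤ : ∀ {z y} p u v → z ≗ p ⊕ u → y ≗ p ⊕ v → dist z y ≤ len u ⊔ len v
  dist-≤ {z} {y} p u v z≗ y≗ = ⊔-mono-≤ (sumFin-mono left) (sumFin-mono right)
    where
    left : ∀ j → z j ∸ (z j ⊓ y j) ≤ u j
    left j rewrite z≗ j | y≗ j = [m+n]∸[m+n]⊓[m+o]≤n (p j) (u j) (v j)
    right : ∀ j → y j ∸ (z j ⊓ y j) ≤ v j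
    right j rewrite z≗ j | y≗ j | ⊓-comm (p j + u j) (p j + v j) = [m+n]∸[m+n]⊓[m+o]≤n (p j) (v j) (u j)

  tame-upper : ∀ {T} → (∀ i z → gens i ≤S eval z → Covered T (gens i) z) →
    ∀ n i → gens i ≤S n → ∀ z → IsFact n z → ∃ λ y → IsFact n y × y i ≢ 0 × dist z y ≤ T
  tame-upper {T} cover n i gi≤n z refl with cover i z gi≤n
  ... | z′ , z′≼z , len-z′ , w , z′≡ , len-w = p ⊕ v , eval-y , yi≢0 , dist-bound
    where
    p v : Factorization
    p j = z j ∸ z′ j
    v = unit i ⊕ w
    z≗ : z ≗ p ⊕ z′
    z≗ j = sym (m∸n+n≡m (z′≼z j))
    eval-y : eval (p ⊕ v) ≡ eval z
    eval-y = begin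
      eval (p ⊕ v)                 ≡⟨ eval-⊕ p v ⟩
      eval p + eval v              ≡⟨ cong (eval p +_) (trans (eval-⊕ (unit i) w) (cong (_+ eval w) (eval-unit i))) ⟩
      eval p + (gens i + eval w)   ≡⟨ cong (eval p +_) z′≡ ⟨
      eval p + eval z′             ≡⟨ eval-⊕ p z′ ⟨
      eval (p ⊕ z′)                ≡⟨ eval-cong z≗ ⟨
      eval z                       ∎
      where open ≡-Reasoning
    yi≢0 : p i + (unit i i + w i) ≢ 0
    yi≢0 = m<n⇒n≢0 (≤-trans (≤-reflexive (sym (unit-self i))) (≤-trans (m≤m+n _ (w i)) (m≤n+m _ (p i))))
    dist-bound : dist z (p ⊕ v) ≤ T
    dist-bound = ≤-trans (dist-≤ p z′ v z≗ (λ _ → refl))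
      (⊔-lub len-z′ (subst (_≤ _) (sym (trans (len-⊕ (unit i) w) (cong (_+ len w) (sumFin-unit≡1 i)))) len-w))

  Σᶠ : ∀ {us} → All InS us → Factorization
  Σᶠ []              = zeroᶠ
  Σᶠ ((z , _) ∷ ps) = z ⊕ Σᶠ ps

  eval-Σᶠ : ∀ {us} (ps : All InS us) → eval (Σᶠ ps) ≡ sum us
  eval-Σᶠ []               = eval-zero
  eval-Σᶠ ((z , refl) ∷ ps) = trans (eval-⊕ z (Σᶠ ps)) (cong (eval z +_) (eval-Σᶠ ps))

  select : ∀ {us} (ps : All InS us) z′ → z′ ≼ Σᶠ ps →
           ∃ λ Ω → Ω ⊆ us × length Ω ≤ len z′ × eval z′ ≤S sum Ω
  select [] z′ z′≼0 = [] , [] , z≤n , subst (eval z′ ≤S_) eval-zero (≼⇒≤S z′≼0)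
  select {_ ∷ us} ((z , refl) ∷ ps) z′ z′≼ = extend (select ps rest rest≼)
    where
    shared rest : Factorization
    shared j = z j ⊓ z′ j
    rest j = z′ j ∸ z j
    shared≼z : shared ≼ z
    shared≼z j = m⊓n≤m (z j) (z′ j)
    rest≼ : rest ≼ Σᶠ ps
    rest≼ j = m≤n+o⇒m∸n≤o (z′ j) (z j) (z′≼ j)
    z′≗ : z′ ≗ shared ⊕ rest
    z′≗ j = sym (m⊓n+n∸m≡n (z j) (z′ j))
    len-z′ : len z′ ≡ len shared + len rest
    len-z′ = trans (len-cong z′≗) (len-⊕ shared rest)
    extend : (∃ λ Ω → Ω ⊆ us × length Ω ≤ len rest × eval rest ≤S sum Ω) →
             ∃ λ Ω → Ω ⊆ eval z ∷ us × length Ω ≤ len z′ × eval z′ ≤S sum Ω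
    extend (Ω , Ω⊆ , len-Ω , rest≤Ω) with len shared in len-shared
    ... | zero  = Ω , eval z ∷ʳ Ω⊆ , subst (length Ω ≤_) (sym len-z″) len-Ω ,
                  subst (_≤S sum Ω) (sym eval-z′) rest≤Ω
      where
      len-z″ : len z′ ≡ len rest
      len-z″ = trans len-z′ (cong (_+ len rest) len-shared)
      eval-z′ : eval z′ ≡ eval rest
      eval-z′ = eval-cong (λ j → trans (z′≗ j) (cong (_+ rest j) (sumFin≡0 shared len-shared j)))
    ... | suc m = eval z ∷ Ω , refl ∷ Ω⊆ ,
                  subst (suc (length Ω) ≤_) (sym len-z″) (s≤s (≤-trans len-Ω (m≤n+m _ m))) ,
                  subst (_≤S (eval z + sum Ω)) (sym eval-z′) (≤S-+ (≼⇒≤S shared≼z) rest≤Ω)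
      where
      len-z″ : len z′ ≡ suc m + len rest
      len-z″ = trans len-z′ (cong (_+ len rest) len-shared)
      eval-z′ : eval z′ ≡ eval shared + eval rest
      eval-z′ = trans (eval-cong z′≗) (eval-⊕ shared rest)

  omega-upper : ∀ {T} → (∀ i z → gens i ≤S eval z → Covered T (gens i) z) →
    ∀ i u → gens i ≤S u → OmegaBound u (gens i) T
  omega-upper cover i u gi≤u us ps refl with cover i (Σᶠ ps) (subst (gens i ≤S_) (sym (eval-Σᶠ ps)) gi≤u)
  ... | z′ , z′≼ , len-z′ , w , z′≡ , _ with select ps z′ z′≼
  ...   | Ω , Ω⊆ , len-Ω , z′≤Ω =
    Ω , Ω⊆ , ≤-trans len-Ω len-z′ , ≤S-trans (≤S-intro w (sym z′≡)) z′≤Ω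

ceilDiv-lower : ∀ m {n} → 1 ≤ n → m ≤ n * ceilDiv m n
ceilDiv-lower m {suc k} _ = subst (m ≤_) (*-comm ((m + k) / suc k) (suc k)) m≤
  where
  m+k≡ : m + k ≡ (m + k) % suc k + (m + k) / suc k * suc k
  m+k≡ = m≡m%n+[m/n]*n (m + k) (suc k)
  m≤ : m ≤ (m + k) / suc k * suc k
  m≤ = +-cancelʳ-≤ k m _ (begin
    m + k                                      ≡⟨ m+k≡ ⟩
    (m + k) % suc k + (m + k) / suc k * suc k  ≤⟨ +-monoˡ-≤ _ (s≤s⁻¹ (m%n<n (m + k) (suc k))) ⟩
    k + (m + k) / suc k * suc k                ≡⟨ +-comm k _ ⟩
    (m + k) / suc k * suc k + k                ∎)
    where open ≤-Reasoning

ceilDiv-least : ∀ m {n} o → 1 ≤ n → m ≤ n * o → ceilDiv m n ≤ o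
ceilDiv-least m {suc k} o _ m≤ = s≤s⁻¹ (m<n*o⇒m/o<n (begin-strict
  m + k            ≤⟨ +-monoˡ-≤ k m≤ ⟩
  suc k * o + k    <⟨ +-monoʳ-< (suc k * o) (n<1+n k) ⟩
  suc k * o + suc k ≡⟨ trans (+-comm _ (suc k)) (cong (suc k +_) (*-comm (suc k) o)) ⟩
  suc o * suc k    ∎))
  where open ≤-Reasoning

module _ {a d : ℕ} .{{_ : NonZero a}} (coprime : Coprime a d) where

  private
    multiple-shift : ∀ P A t → P * a ≡ A * a + suc t * d → a ≤ suc t × A + d ≤ P
    multiple-shift P A t eq
      with m≤n⇒∃[o]m+o≡n (*-cancelʳ-≤ A P a (subst (A * a ≤_) (sym eq) (m≤m+n (A * a) _)))
    ... | m , refl = a≤t , +-monoʳ-≤ A d≤m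
      where
      ma≡td : m * a ≡ suc t * d
      ma≡td = +-cancelˡ-≡ (A * a) _ _ (trans (sym (*-distribʳ-+ a A m)) eq)
      a≤t : a ≤ suc t
      a≤t = ∣⇒≤ (coprime-divisor coprime (divides m (trans (*-comm d (suc t)) (sym ma≡td))))
      d≤m : d ≤ m
      d≤m = *-cancelʳ-≤ d m a (begin
        d * a      ≡⟨ *-comm d a ⟩
        a * d      ≤⟨ *-monoˡ-≤ d a≤t ⟩
        suc t * d  ≡⟨ ma≡td ⟨
        m * a      ∎)
        where open ≤-Reasoning

  -- P a + u d = A a + v d with u < v gives (P − A) a = (v − u) d, so a ∣ v − u and d ∣ P − A.
  coprime-shift : ∀ {P u A v} → P * a + u * d ≡ A * a + v * d → u < v → u + a ≤ v × A + d ≤ P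
  coprime-shift {P} {u} {A} {v} eq u<v with m≤n⇒∃[o]m+o≡n u<v
  ... | t , refl with multiple-shift P A t (+-cancelʳ-≡ (u * d) _ _ (trans eq (rearrange A a u t d)))
    where
    rearrange : ∀ A a u t d → A * a + (suc u + t) * d ≡ A * a + suc t * d + u * d
    rearrange = solve-∀
  ... | a≤t , A+d≤P = subst (u + a ≤_) (+-suc u t) (+-monoʳ-≤ u a≤t) , A+d≤P

  level-≤ : ∀ {P u A v} → P * a + u * d ≡ A * a + v * d → v < u + a → P ≤ A
  level-≤ {P} {u} {A} {v} eq v<u+a with u <? v
  ... | yes u<v = contradiction (proj₁ (coprime-shift {P} {u} {A} {v} eq u<v)) (<⇒≱ v<u+a)
  ... | no u≮v = *-cancelʳ-≤ P A a (+-cancelʳ-≤ (u * d) (P * a) (A * a) (begin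
    P * a + u * d  ≡⟨ eq ⟩
    A * a + v * d  ≤⟨ +-monoʳ-≤ (A * a) (*-monoˡ-≤ d (≮⇒≥ u≮v)) ⟩
    A * a + u * d  ∎))
    where open ≤-Reasoning

module ArithmeticSequence (a d h x : ℕ) where
  open Factorizations (arithGens a d h x) public

  gen : Fin (suc x) → ℕ
  gen = arithGens a d h x

  count indexSum : Factorization → ℕ
  count z = sumFin (λ j → z (suc j))
  indexSum z = sumFin (λ j → suc (toℕ j) * z (suc j))

  eval-profile : ∀ z → eval z ≡ (z zero + h * count z) * a + indexSum z * d
  eval-profile z = begin
    z zero * a + sumFin (λ j → z (suc j) * (h * a + suc (toℕ j) * d))
      ≡⟨ cong (z zero * a +_) (sumFin-cong (λ j → expand (z (suc j)) (h * a) (suc (toℕ j)) d)) ⟩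
    z zero * a + sumFin (λ j → h * a * z (suc j) + d * (suc (toℕ j) * z (suc j)))
      ≡⟨ cong (z zero * a +_) (sumFin-+ (λ j → h * a * z (suc j)) (λ j → d * (suc (toℕ j) * z (suc j)))) ⟩
    z zero * a + (sumFin (λ j → h * a * z (suc j)) + sumFin (λ j → d * (suc (toℕ j) * z (suc j))))
      ≡⟨ cong (z zero * a +_) (cong₂ _+_ (sumFin-* (h * a) (λ j → z (suc j)))
                                         (sumFin-* d (λ j → suc (toℕ j) * z (suc j)))) ⟩
    z zero * a + (h * a * count z + d * indexSum z)
      ≡⟨ collect (z zero) a h (count z) (indexSum z) d ⟩
    (z zero + h * count z) * a + indexSum z * d ∎
    where
    open ≡-Reasoning
    expand : ∀ m g t d → m * (g + t * d) ≡ g * m + d * (t * m)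
    expand = solve-∀
    collect : ∀ c a h k s d → c * a + (h * a * k + d * s) ≡ (c + h * k) * a + s * d
    collect = solve-∀

  indexSum≤ : ∀ z → indexSum z ≤ x * count z
  indexSum≤ z = subst (indexSum z ≤_) (sumFin-* x (λ j → z (suc j)))
    (sumFin-mono (λ j → *-monoˡ-≤ (z (suc j)) (toℕ<n j)))

  index≤indexSum : ∀ z j → 1 ≤ z (suc j) → suc (toℕ j) ≤ indexSum z
  index≤indexSum z j 1≤zj = begin
    suc (toℕ j)              ≡⟨ *-identityʳ _ ⟨
    suc (toℕ j) * 1          ≤⟨ *-monoʳ-≤ (suc (toℕ j)) 1≤zj ⟩
    suc (toℕ j) * z (suc j)  ≤⟨ term≤sumFin (λ i → suc (toℕ i) * z (suc i)) j ⟩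
    indexSum z               ∎
    where open ≤-Reasoning

  inS-block : ∀ r → r ≤ x → InS (h * a + r * d)
  inS-block zero    _   = subst InS (sym (+-identityʳ (h * a))) (inS-multiple h zero)
  inS-block (suc r) r<x = subst (λ t → InS (h * a + suc t * d)) (toℕ-fromℕ< r<x) (unit j , eval-unit j)
    where
    j : Fin (suc x)
    j = suc (fromℕ< r<x)

  inS-level : ∀ m E r → r ≤ x * m → InS ((h * m + E) * a + r * d)
  inS-level m       E zero    _  = subst InS (sym (+-identityʳ _)) (inS-multiple (h * m + E) zero)
  inS-level zero    E (suc r) r≤ = contradiction (subst (suc r ≤_) (*-zeroʳ x) r≤) λ ()
  inS-level (suc m) E (suc r) r≤ = subst InS eq
    (inS-+ (inS-block (x ⊓ suc r) (m⊓n≤m x (suc r)))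
           (inS-level m E (suc r ∸ x) (m≤n+o⇒m∸n≤o (suc r) x (subst (suc r ≤_) (*-suc x m) r≤))))
    where
    split : ∀ h a d m E s₁ s₂ →
            h * a + s₁ * d + ((h * m + E) * a + s₂ * d) ≡ (h * suc m + E) * a + (s₁ + s₂) * d
    split = solve-∀
    eq : h * a + (x ⊓ suc r) * d + ((h * m + E) * a + (suc r ∸ x) * d) ≡ (h * suc m + E) * a + suc r * d
    eq = trans (split h a d m E (x ⊓ suc r) (suc r ∸ x))
               (cong (λ t → (h * suc m + E) * a + t * d) (m⊓n+n∸m≡n x (suc r)))

module Bounds (a d h x : ℕ) (1≤a : 1 ≤ a) (1≤h : 1 ≤ h) (1≤x : 1 ≤ x) (x≤a∸1 : x ≤ a ∸ 1)
              (coprime : Coprime a d) where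
  open ArithmeticSequence a d h x public

  instance
    a≢0 : NonZero a
    a≢0 = >-nonZero 1≤a
    h≢0 : NonZero h
    h≢0 = >-nonZero 1≤h

  q T : ℕ
  q = ceilDiv (a ∸ 1) x
  T = (q + 1) * h + d

  T≡ : T ≡ h + h * q + d
  T≡ = expand q h d
    where
    expand : ∀ q h d → (q + 1) * h + d ≡ h + h * q + d
    expand = solve-∀

  index<a : ∀ j → suc (toℕ j) < a
  index<a j = m≤pred[n]⇒suc[m]≤n (≤-trans (toℕ<n j) x≤a∸1)

  hq<T : h * q < T
  hq<T = subst (h * q <_) (sym T≡) (≤-trans (m<n+m (h * q) 1≤h) (m≤m+n _ d))

  T∸1<T : T ∸ 1 < T
  T∸1<T = m≤pred[n]⇒suc[m]≤n {{>-nonZero (≤-<-trans z≤n hq<T)}} ≤-refl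

  ceilDiv≤q : ∀ {r} → r < a → ceilDiv r x ≤ q
  ceilDiv≤q {r} r<a = ceilDiv-least r q 1≤x (≤-trans (suc[m]≤n⇒m≤pred[n] r<a) (ceilDiv-lower (a ∸ 1) 1≤x))

  inS-above : ∀ P r → h * ceilDiv r x ≤ P → InS (P * a + r * d)
  inS-above P r h⌈r⌉≤P with m≤n⇒∃[o]m+o≡n h⌈r⌉≤P
  ... | E , refl = inS-level (ceilDiv r x) E r (ceilDiv-lower r 1≤x)

  level-form : ∀ w → ∃₂ λ L r → eval w ≡ L * a + r * d × r < a × len w ≤ L
  level-form w = L , s % a , eq , m%n<n s a ,
                 ≤-trans (+-monoʳ-≤ (w zero) (m≤n*m (count w) h)) (m≤m+n _ _)
    where
    s = indexSum w
    L = w zero + h * count w + s / a * d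
    eq : eval w ≡ L * a + s % a * d
    eq = begin
      eval w                                               ≡⟨ eval-profile w ⟩
      (w zero + h * count w) * a + s * d
        ≡⟨ cong (λ t → (w zero + h * count w) * a + t * d) (m≡m%n+[m/n]*n s a) ⟩
      (w zero + h * count w) * a + (s % a + s / a * a) * d ≡⟨ regroup (w zero + h * count w) a (s % a) (s / a) d ⟩
      L * a + s % a * d                                    ∎
      where
      open ≡-Reasoning
      regroup : ∀ N a r t d → N * a + (r + t * a) * d ≡ (N + t * d) * a + r * d
      regroup = solve-∀

  len≤weight : ∀ z → len z ≤ z zero + h * count z
  len≤weight z = +-monoʳ-≤ (z zero) (m≤n*m (count z) h)

  len≤T : ∀ z → 1 ≤ count z → z zero + h * count z < h + T → len z ≤ T
  len≤T z 1≤k lt = bound (z zero) (count z) 1≤k lt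
    where
    bound : ∀ c k → 1 ≤ k → c + h * k < h + T → c + k ≤ T
    bound c (suc k) _ lt = subst (_≤ T) (sym (+-suc c k))
      (≤-<-trans (+-monoʳ-≤ c (m≤n*m k h))
        (+-cancelˡ-< h (c + h * k) T (subst (_< h + T) (regroup c h k) lt)))
      where
      regroup : ∀ c h k → c + h * suc k ≡ h + (c + h * k)
      regroup = solve-∀

  count-pos : ∀ {z z₁ j} → z ≗ z₁ ⊕ unit (suc j) → 1 ≤ count z
  count-pos {z} {z₁} {j} z≗ = ≤-trans (atom-pos {z} {z₁} {suc j} z≗) (term≤sumFin (λ i → z (suc i)) j)

  module Reduction {b β i : ℕ} (b≡ : b ≡ β * a + i * d) (1≤β : 1 ≤ β) (β≤h : β ≤ h) (i<a : i < a) where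

    1≤b : 1 ≤ b
    1≤b = subst (1 ≤_) (sym b≡) (≤-trans (*-mono-≤ 1≤β 1≤a) (m≤m+n _ _))

    Outcome : Factorization → ℕ → Set
    Outcome z L = Shrinkable b z ⊎ (L < T × len z ≤ T)

    profile-eq : ∀ z {L r} → eval z ≡ b + (L * a + r * d) →
                 (z zero + h * count z) * a + indexSum z * d ≡ (β + L) * a + (i + r) * d
    profile-eq z {L} {r} eq = begin
      (z zero + h * count z) * a + indexSum z * d ≡⟨ eval-profile z ⟨
      eval z                                      ≡⟨ eq ⟩
      b + (L * a + r * d)                         ≡⟨ cong (_+ (L * a + r * d)) b≡ ⟩
      β * a + i * d + (L * a + r * d)             ≡⟨ regroup β a i d L r ⟩
      (β + L) * a + (i + r) * d                   ∎
      where
      open ≡-Reasoning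
      regroup : ∀ β a i d L r → β * a + i * d + (L * a + r * d) ≡ (β + L) * a + (i + r) * d
      regroup = solve-∀

    weight-≤ : ∀ z A v → (z zero + h * count z) * a + indexSum z * d ≡ A * a + v * d →
               v < indexSum z + a → z zero + h * count z ≤ A
    weight-≤ z A v = level-≤ coprime {z zero + h * count z} {indexSum z} {A} {v}

    weight-bound : ∀ z {L r} → eval z ≡ b + (L * a + r * d) → r < a → z zero + h * count z ≤ β + L + d
    weight-bound z {L} {r} eq r<a with i + r <? a
    ... | yes i+r<a =
      ≤-trans (weight-≤ z (β + L) (i + r) (profile-eq z eq) (≤-trans i+r<a (m≤n+m a _))) (m≤m+n _ d)
    ... | no i+r≮a with m≤n⇒∃[o]m+o≡n (≮⇒≥ i+r≮a)
    ...   | v , a+v≡ = weight-≤ z (β + L + d) v eq′ (≤-trans v<a (m≤n+m a _))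
      where
      regroup : ∀ β L a d v → (β + L) * a + (a + v) * d ≡ (β + L + d) * a + v * d
      regroup = solve-∀
      eq′ : (z zero + h * count z) * a + indexSum z * d ≡ (β + L + d) * a + v * d
      eq′ = trans (profile-eq z eq) (trans (cong (λ t → (β + L) * a + t * d) (sym a+v≡)) (regroup β L a d v))
      v<a : v < a
      v<a = +-cancelˡ-< a v a (subst (_< a + a) (sym a+v≡) (+-mono-< i<a r<a))

    weight-bound-below : ∀ z {L r} → eval z ≡ b + (L * a + r * d) → r < indexSum z →
                         z zero + h * count z ≤ β + L
    weight-bound-below z {L} {r} eq r<s =
      weight-≤ z (β + L) (i + r) (profile-eq z eq) (subst (i + r <_) (+-comm a _) (+-mono-< i<a r<s))

    shrink : ∀ {z} z₁ l L r V → z ≗ z₁ ⊕ unit l → eval z ≡ b + (L * a + r * d) →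
             V + gen l ≡ L * a + r * d → InS V → Shrinkable b z
    shrink {z} z₁ l L r _ z≗ eq V+g≡ (w , refl) = l , z₁ , z≗ , ≤S-intro w (+-cancelʳ-≡ (gen l) _ _ (begin
      b + eval w + gen l     ≡⟨ +-assoc b (eval w) (gen l) ⟩
      b + (eval w + gen l)   ≡⟨ cong (b +_) V+g≡ ⟩
      b + (L * a + r * d)    ≡⟨ eq ⟨
      eval z                 ≡⟨ eval-drop {z} {z₁} {l} z≗ ⟩
      eval z₁ + gen l        ∎))
      where open ≡-Reasoning

    drop-n₀ : ∀ {z z₁ L r} → z ≗ z₁ ⊕ unit zero → eval z ≡ b + (L * a + r * d) → r < a → Outcome z L
    drop-n₀ {z} {z₁} {L} {r} z≗ eq r<a with suc (h * ceilDiv r x) ≤? L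
    ... | yes h⌈r⌉<L with m≤n⇒∃[o]m+o≡n h⌈r⌉<L
    ...   | E , refl = inj₁ (shrink z₁ zero (suc P + E) r ((P + E) * a + r * d) z≗ eq
                                (regroup P E a r d) (inS-above (P + E) r (m≤m+n P E)))
      where
      P = h * ceilDiv r x
      regroup : ∀ P E a r d → (P + E) * a + r * d + a ≡ (suc P + E) * a + r * d
      regroup = solve-∀
    drop-n₀ {z} {z₁} {L} {r} z≗ eq r<a | no h⌈r⌉≮L = inj₂ (≤-<-trans L≤hq hq<T , len≤)
      where
      L≤hq : L ≤ h * q
      L≤hq = ≤-trans (s≤s⁻¹ (≰⇒> h⌈r⌉≮L)) (*-monoʳ-≤ h (ceilDiv≤q r<a))
      len≤ : len z ≤ T
      len≤ = begin
        len z                     ≤⟨ len≤weight z ⟩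
        z zero + h * count z      ≤⟨ weight-bound z eq r<a ⟩
        β + L + d                 ≤⟨ +-monoˡ-≤ d (+-mono-≤ β≤h L≤hq) ⟩
        h + h * q + d             ≡⟨ T≡ ⟨
        T                         ∎
        where open ≤-Reasoning

    drop-index≤r : ∀ {z z₁ j L r₁} → z ≗ z₁ ⊕ unit (suc j) →
                 eval z ≡ b + (L * a + (suc (toℕ j) + r₁) * d) → suc (toℕ j) + r₁ < a → Outcome z L
    drop-index≤r {z} {z₁} {j} {L} {r₁} z≗ eq r<a with h + h * ceilDiv r₁ x ≤? L
    ... | yes fits with m≤n⇒∃[o]m+o≡n fits
    ...   | E , refl = inj₁ (shrink z₁ (suc j) (h + P + E) (suc (toℕ j) + r₁) ((P + E) * a + r₁ * d) z≗ eq
                                (regroup P E a r₁ h (suc (toℕ j)) d) (inS-above (P + E) r₁ (m≤m+n P E)))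
      where
      P = h * ceilDiv r₁ x
      regroup : ∀ P E a r h J d → (P + E) * a + r * d + (h * a + J * d) ≡ (h + P + E) * a + (J + r) * d
      regroup = solve-∀
    drop-index≤r {z} {z₁} {j} {L} {r₁} z≗ eq r<a | no ¬fits =
      inj₂ (<-≤-trans L< (subst (h + h * q ≤_) (sym T≡) (m≤m+n _ d)) , len≤)
      where
      L< : L < h + h * q
      L< = <-≤-trans (≰⇒> ¬fits)
             (+-monoʳ-≤ h (*-monoʳ-≤ h (ceilDiv≤q (≤-<-trans (m≤n+m r₁ (suc (toℕ j))) r<a))))
      len≤ : len z ≤ T
      len≤ = len≤T z (count-pos {z} {z₁} {j} z≗) (begin-strict
        z zero + h * count z      ≤⟨ weight-bound z eq r<a ⟩
        β + L + d                 ≤⟨ +-monoˡ-≤ d (+-monoˡ-≤ L β≤h) ⟩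
        h + L + d                 <⟨ +-monoˡ-< d (+-monoʳ-< h L<) ⟩
        h + (h + h * q) + d       ≡⟨ trans (+-assoc h _ d) (cong (h +_) (sym T≡)) ⟩
        h + T                     ∎)
        where open ≤-Reasoning

    drop-index>r : ∀ {z z₁ j L r e r₂} → z ≗ z₁ ⊕ unit (suc j) → eval z ≡ b + (L * a + r * d) →
                 r + suc e ≡ suc (toℕ j) → suc e + r₂ ≡ a → Outcome z L
    drop-index>r {z} {z₁} {j} {L} {r} {e} {r₂} z≗ eq r+e≡ e+r₂≡ with h + d + h * ceilDiv r₂ x ≤? L
    ... | yes fits with m≤n⇒∃[o]m+o≡n fits
    ...   | E , refl = inj₁ (shrink z₁ (suc j) (h + d + P + E) r ((P + E) * a + r₂ * d) z≗ eq
                                (subst₂ (λ A J → (P + E) * A + r₂ * d + (h * A + J * d) ≡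
                                                 (h + d + P + E) * A + r * d)
                                        e+r₂≡ r+e≡ (regroup P E e r₂ d h r))
                                (inS-above (P + E) r₂ (m≤m+n P E)))
      where
      P = h * ceilDiv r₂ x
      -- (L − h − d) a + (r + a − j) d + n_j = L a + r d, written with a = suc e + r₂ and j = r + suc e
      regroup : ∀ P E e r₂ d h r → (P + E) * (suc e + r₂) + r₂ * d + (h * (suc e + r₂) + (r + suc e) * d) ≡
                                   (h + d + P + E) * (suc e + r₂) + r * d
      regroup = solve-∀
    drop-index>r {z} {z₁} {j} {L} {r} {e} {r₂} z≗ eq r+e≡ e+r₂≡ | no ¬fits = inj₂ (L<T , len≤)
      where
      L<T : L < T
      L<T = <-≤-trans (≰⇒> ¬fits) (subst (h + d + h * ceilDiv r₂ x ≤_) (trans (regroup h d q) (sym T≡))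
              (+-monoʳ-≤ (h + d) (*-monoʳ-≤ h (ceilDiv≤q (subst (r₂ <_) e+r₂≡ (m<n+m r₂ z<s))))))
        where
        regroup : ∀ h d q → h + d + h * q ≡ h + h * q + d
        regroup = solve-∀
      r<s : r < indexSum z
      r<s = <-≤-trans (subst (r <_) r+e≡ (m<m+n r z<s)) (index≤indexSum z j (atom-pos {z} {z₁} {suc j} z≗))
      len≤ : len z ≤ T
      len≤ = len≤T z (count-pos {z} {z₁} {j} z≗) (begin-strict
        z zero + h * count z      ≤⟨ weight-bound-below z eq r<s ⟩
        β + L                     ≤⟨ +-monoˡ-≤ L β≤h ⟩
        h + L                     <⟨ +-monoʳ-< h L<T ⟩
        h + T                     ∎)
        where open ≤-Reasoning

    drop-any : ∀ {z z₁ L r} l → z ≗ z₁ ⊕ unit l → eval z ≡ b + (L * a + r * d) → r < a → Outcome z L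
    drop-any zero    z≗ eq r<a = drop-n₀ z≗ eq r<a
    drop-any {r = r} (suc j) z≗ eq r<a with suc (toℕ j) ≤? r
    ... | yes J≤r with m≤n⇒∃[o]m+o≡n J≤r
    ...   | r₁ , refl = drop-index≤r z≗ eq r<a
    drop-any {r = r} (suc j) z≗ eq r<a | no J≰r with m≤n⇒∃[o]m+o≡n (≰⇒> J≰r)
    ...   | e , r+e≡
      with m≤n⇒∃[o]m+o≡n (≤-trans (m≤n+m (suc e) r) (≤-trans (≤-reflexive r+e≡′) (<⇒≤ (index<a j))))
      where
      r+e≡′ : r + suc e ≡ suc (toℕ j)
      r+e≡′ = trans (+-suc r e) r+e≡
    ...     | r₂ , e+r₂≡ = drop-index>r z≗ eq (trans (+-suc r e) r+e≡) e+r₂≡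

    reduce-or-compact : ∀ z → b ≤S eval z → Shrinkable b z ⊎ Compact T b z
    reduce-or-compact z b≤z with ≤S-elim b≤z
    ... | w , b+w≡ with level-form w
    ... | L , r , w≡ , r<a , len-w with atom-of-pos z (≤-trans 1≤b (proj₁ b≤z))
    ... | l , 1≤zl with drop-atom z l 1≤zl
    ... | z₁ , z≗ with drop-any l z≗ (trans (sym b+w≡) (cong (b +_) w≡)) r<a
    ... | inj₁ shrinkable   = inj₁ shrinkable
    ... | inj₂ (L<T , len≤) = inj₂ (len≤ , w , sym b+w≡ , ≤-<-trans len-w L<T)

  covered : ∀ l z → gen l ≤S eval z → Covered T (gen l) z
  covered zero    = descend (Reduction.reduce-or-compact a≡ ≤-refl 1≤h 1≤a)
    where
    a≡ : a ≡ 1 * a + 0 * d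
    a≡ = sym (trans (+-identityʳ (1 * a)) (*-identityˡ a))
  covered (suc j) = descend (Reduction.reduce-or-compact refl 1≤h ≤-refl (index<a j))

  q-pred : ∃ λ q₁ → q ≡ suc q₁
  q-pred with q in q≡
  ... | suc q₁ = q₁ , refl
  ... | zero   = contradiction (≤-trans x≤a∸1 (subst (λ t → a ∸ 1 ≤ x * t) q≡ (ceilDiv-lower (a ∸ 1) 1≤x)))
                             (<⇒≱ (subst (_< x) (sym (*-zeroʳ x)) 1≤x))

  extremal-index : ∃₂ λ q₁ (j : Fin x) → q ≡ suc q₁ × suc (x * q₁ + suc (toℕ j)) ≡ a
  extremal-index with q-pred
  ... | q₁ , q≡ with m≤n⇒∃[o]m+o≡n below
    where
    below : suc (x * q₁) ≤ a ∸ 1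
    below = ≰⇒> λ a∸1≤ → <-irrefl refl (subst (_≤ q₁) q≡ (ceilDiv-least (a ∸ 1) q₁ 1≤x a∸1≤))
  ... | t , xq₁+t≡ = q₁ , fromℕ< t<x , q≡ , a≡
    where
    xq₁+t≡′ : x * q₁ + suc t ≡ a ∸ 1
    xq₁+t≡′ = trans (+-suc (x * q₁) t) xq₁+t≡
    t<x : t < x
    t<x = +-cancelˡ-≤ (x * q₁) (suc t) x (begin
      x * q₁ + suc t   ≡⟨ xq₁+t≡′ ⟩
      a ∸ 1            ≤⟨ ceilDiv-lower (a ∸ 1) 1≤x ⟩
      x * q            ≡⟨ cong (x *_) q≡ ⟩
      x * suc q₁       ≡⟨ trans (*-suc x q₁) (+-comm x _) ⟩
      x * q₁ + x       ∎)
      where open ≤-Reasoning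
    a≡ : suc (x * q₁ + suc (toℕ (fromℕ< t<x))) ≡ a
    a≡ = trans (cong (λ u → suc (x * q₁ + suc u)) (toℕ-fromℕ< t<x)) (trans (cong suc xq₁+t≡′) (suc-pred a))

  module Extremal {q₁ : ℕ} (j : Fin x) (q≡ : q ≡ suc q₁) (a≡ : suc (x * q₁ + suc (toℕ j)) ≡ a) where

    J : ℕ
    J = suc (toℕ j)

    star : Fin (suc x)
    star = suc j

    -- a ∣ indexSum w + J forces indexSum w > x (q − 1), hence count w ≥ q.
    star-minimal : ∀ w c → eval w + gen star ≡ c * a → T + w zero ≤ c
    star-minimal w c eq with coprime-shift coprime {c} {0} {w zero + h * count w + h} {indexSum w + J} eq′ z<s′
      where
      regroup : ∀ C k s h a J d → (C + h * k) * a + s * d + (h * a + J * d) ≡ (C + h * k + h) * a + (s + J) * d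
      regroup = solve-∀
      eq′ : c * a + 0 * d ≡ (w zero + h * count w + h) * a + (indexSum w + J) * d
      eq′ = trans (+-identityʳ (c * a)) (trans (sym eq) (trans (cong (_+ gen star) (eval-profile w))
                  (regroup (w zero) (count w) (indexSum w) h a J d)))
      z<s′ : 0 < indexSum w + J
      z<s′ = ≤-trans (s≤s z≤n) (m≤n+m J (indexSum w))
    ... | a≤s+J , bound = begin
      T + w zero                      ≡⟨ cong (_+ w zero) T≡ ⟩
      h + h * q + d + w zero          ≡⟨ regroup h q d (w zero) ⟩
      w zero + h * q + h + d          ≤⟨ +-monoˡ-≤ d (+-monoˡ-≤ h (+-monoʳ-≤ (w zero) (*-monoʳ-≤ h q≤k))) ⟩
      w zero + h * count w + h + d    ≤⟨ bound ⟩
      c                               ∎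
      where
      open ≤-Reasoning
      regroup : ∀ h q d c → h + h * q + d + c ≡ c + h * q + h + d
      regroup = solve-∀
      xq₁<s : x * q₁ < indexSum w
      xq₁<s = +-cancelʳ-≤ J (suc (x * q₁)) (indexSum w) (subst (_≤ indexSum w + J) (sym a≡) a≤s+J)
      q≤k : q ≤ count w
      q≤k = subst (_≤ count w) (sym q≡) (*-cancelˡ-< x q₁ (count w) (<-≤-trans xq₁<s (indexSum≤ w)))

    star≤S : gen star ≤S (T * a)
    star≤S with inS-level q 0 (suc (x * q₁)) fits
      where
      fits : suc (x * q₁) ≤ x * q
      fits = subst (suc (x * q₁) ≤_) (sym (trans (cong (x *_) q≡) (*-suc x q₁))) (+-monoˡ-≤ (x * q₁) 1≤x)
    ... | w , eval-w = ≤S-intro w (trans (cong (gen star +_) eval-w)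
      (subst (λ A → h * A + J * d + ((h * q + 0) * A + suc (x * q₁) * d) ≡ T * A) a≡ (regroup h J d q x q₁)))
      where
      regroup : ∀ h J d q x q₁ →
                h * suc (x * q₁ + J) + J * d + ((h * q + 0) * suc (x * q₁ + J) + suc (x * q₁) * d)
                ≡ ((q + 1) * h + d) * suc (x * q₁ + J)
      regroup = solve-∀

    tame-lower : Σ ℕ λ n → Σ (Fin (suc x)) λ i → gen i ≤S n × Σ Factorization λ z → IsFact n z ×
                   (∀ y → IsFact n y → y i ≢ 0 → T ≤ dist z y)
    tame-lower = T * a , star , star≤S , T ·unit zero , eval-·unit T zero , far
      where
      far : ∀ y → eval y ≡ T * a → y star ≢ 0 → T ≤ dist (T ·unit zero) y
      far y eval-y y≢0 with drop-atom y star (n≢0⇒n>0 y≢0)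
      ... | y₁ , y≗ = ≤-trans (≤-reflexive (sym first))
                        (≤-trans (term≤sumFin (λ i → z i ∸ (z i ⊓ y i)) zero) (m≤m⊔n _ _))
        where
        z = T ·unit zero
        y₁0≡0 : y₁ zero ≡ 0
        y₁0≡0 = n≤0⇒n≡0 (+-cancelˡ-≤ T (y₁ zero) 0 (subst (T + y₁ zero ≤_) (sym (+-identityʳ T))
                  (star-minimal y₁ T (trans (sym (eval-drop {y} {y₁} {star} y≗)) eval-y))))
        y0≡0 : y zero ≡ 0
        y0≡0 = trans (y≗ zero) (trans (+-identityʳ (y₁ zero)) y₁0≡0)
        first : T * 1 ∸ (T * 1 ⊓ y zero) ≡ T
        first = trans (cong (λ t → T * 1 ∸ (T * 1 ⊓ t)) y0≡0)
                      (trans (cong (T * 1 ∸_) (⊓-zeroʳ (T * 1))) (*-identityʳ T))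

    omega-lower : Σ (Fin (suc x)) λ i → Σ ℕ λ u → gen i ≤S u × ¬ OmegaBound u (gen i) (T ∸ 1)
    omega-lower = star , T * a , star≤S , refute
      where
      refute : ¬ OmegaBound (T * a) (gen star) (T ∸ 1)
      refute bound with bound (replicate T a) (replicate⁺ T (unit zero , eval-unit zero))
                              (trans (sum-copies (replicate⁺ T refl)) (cong (_* a) (length-replicate T)))
      ... | Ω , Ω⊆ , len-Ω , star≤Ω with ≤S-elim star≤Ω
      ...   | w , star+w≡ = <-irrefl refl (begin-strict
        T                  ≤⟨ m≤m+n T (w zero) ⟩
        T + w zero         ≤⟨ star-minimal w (length Ω) (trans (+-comm (eval w) _) (trans star+w≡ sum-Ω)) ⟩
        length Ω           ≤⟨ len-Ω ⟩
        T ∸ 1              <⟨ T∸1<T ⟩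
        T                  ∎)
        where
        open ≤-Reasoning
        sum-Ω : sum Ω ≡ length Ω * a
        sum-Ω = sum-copies (All-resp-⊆ Ω⊆ (replicate⁺ T refl))

  theorem : TameDegreeIs T × OmegaIs T
  theorem with extremal-index
  ... | q₁ , j , q≡ , a≡ = (tame-upper covered , tame-lower) , (omega-upper covered , omega-lower)
    where open Extremal j q≡ a≡

mainTheorem5 : (a d h x : ℕ) → 1 ≤ a → 1 ≤ d → 1 ≤ h → 1 ≤ x → x ≤ a ∸ 1 → gcd a d ≡ 1 →
    Monoid.TameDegreeIs (arithGens a d h x) ((ceilDiv (a ∸ 1) x + 1) * h + d)
    × Monoid.OmegaIs (arithGens a d h x) ((ceilDiv (a ∸ 1) x + 1) * h + d)
mainTheorem5 a d h x 1≤a _ 1≤h 1≤x x≤a∸1 gcd≡1 =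
  Bounds.theorem a d h x 1≤a 1≤h 1≤x x≤a∸1 (gcd≡1⇒coprime gcd≡1)
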